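{- Let $\mathcal{M}$ be a countably infinite graph which is $\geq$$k$-homogeneous for some $k\geq1$, is not $1$-homogeneous, and contains an induced subgraph isomorphic to $K_\infty$. Suppose $\mathcal{M}$ has exactly two $1$-orbits, an infinite one $p$ and a finite one $q$. If $a\in p$, then there are at most $k+|q|-1$ vertices of $\mathcal{M}$ to which $a$ is not adjacent.
   Context: A graph is $k$-homogeneous if every embedding (injective map preserving adjacency and non-adjacency) of an induced subgraph with $k$ vertices into the graph extends to an automorphism; $\geq$$k$-homogeneous means $t$-homogeneous for all $t\geq k$. A $1$-orbit is an orbit of the automorphism group on vertices. $K_\infty$ is the countably infinite complete graph. -}

module Defs where

open import Data.Nat using (ℕ; _≤_; _≥_)
open import Data.Bool using (Bool; true; false)
open import Data.Fin using (Fin)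
open import Data.Product using (Σ; ∃; _×_; _,_)
open import Data.List using (List; length)
open import Data.List.Membership.Propositional using (_∈_; _∉_)
open import Data.List.Relation.Unary.Unique.Propositional using (Unique)
open import Relation.Binary.PropositionalEquality using (_≡_; _≢_)
open import Relation.Nullary using (¬_)
open import Function.Definitions using (Injective)

record IsGraph (E : ℕ → ℕ → Bool) : Set where
  field
    sym   : ∀ x y → E x y ≡ E y x
    irrefl : ∀ x → E x x ≡ false

record Automorphism (E : ℕ → ℕ → Bool) : Set where
  field
    fun     : ℕ → ℕ
    inv     : ℕ → ℕ
    inv-l   : ∀ x → inv (fun x) ≡ x
    inv-r   : ∀ x → fun (inv x) ≡ x
    preserves : ∀ x y → E (fun x) (fun y) ≡ E x y

open Automorphism public

-- t-homogeneous: every embedding of an induced subgraph on t vertices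
-- (listed injectively as v : Fin t → ℕ) into the graph (w : Fin t → ℕ,
-- injective, preserving adjacency and non-adjacency) extends to an automorphism.
Homogeneous : ℕ → (ℕ → ℕ → Bool) → Set
Homogeneous t E =
  (v w : Fin t → ℕ) → Injective _≡_ _≡_ v → Injective _≡_ _≡_ w →
  (∀ i j → E (w i) (w j) ≡ E (v i) (v j)) →
  Σ (Automorphism E) λ σ → ∀ i → fun σ (v i) ≡ w i

GeHomogeneous : ℕ → (ℕ → ℕ → Bool) → Set
GeHomogeneous k E = ∀ t → t ≥ k → Homogeneous t E

ContainsKω : (ℕ → ℕ → Bool) → Set
ContainsKω E = Σ (ℕ → ℕ) λ h → Injective _≡_ _≡_ h × (∀ i j → i ≢ j → E (h i) (h j) ≡ true)

SameOrbit : (ℕ → ℕ → Bool) → ℕ → ℕ → Set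
SameOrbit E x y = Σ (Automorphism E) λ σ → fun σ x ≡ y

IsFiniteOrbit : (ℕ → ℕ → Bool) → List ℕ → Set
IsFiniteOrbit E qs = Unique qs × Σ ℕ λ b → b ∈ qs × (∀ x → (x ∈ qs → SameOrbit E b x) × (SameOrbit E b x → x ∈ qs))

-- Exactly two 1-orbits: the finite orbit enumerated by qs, and its complement,
-- which forms a single orbit (necessarily infinite, since ℕ is infinite).
ComplementIsOrbit : (ℕ → ℕ → Bool) → List ℕ → Set
ComplementIsOrbit E qs = ∀ x y → x ∉ qs → y ∉ qs → SameOrbit E x y

NonNeighboursAtMost : (ℕ → ℕ → Bool) → ℕ → ℕ → Set
NonNeighboursAtMost E a N =
  (xs : List ℕ) → Unique xs →
  (∀ x → x ∈ xs → (x ≢ a) × (E a x ≡ false)) → length xs ≤ N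

-- Write k = k₀ + 1. If some b in the finite orbit q had a neighbour in the
-- infinite orbit p, transitivity on p would give every vertex of p a neighbour
-- in q. Take a clique of |q| + k₀|q| + 1 vertices; more than k₀|q| of them lie
-- in p, so by pigeonhole some b ∈ q is adjacent to a clique c ∷ S of more than
-- k₀ of them. Then b and c are adjacent to every vertex of S, so the map
-- b ↦ c fixing S is an embedding of k₀ + 1 ≥ k vertices; by homogeneity it
-- extends to an automorphism, putting c into q. Hence q has no neighbour in p.
-- Now if a ∈ p had more than k₀ + |q| non-neighbours, at least k₀ of them lie
-- in p, and a and any b ∈ q are both non-adjacent to all of them; the same
-- extension argument maps b to a.
module Submission where

open import Defs
open import Data.Bool using (Bool; true; false; _≟_)
open import Data.Bool.Properties using (¬-not)
open import Data.Empty using (⊥)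
open import Data.Fin using (Fin; zero; suc)
import Data.Fin.Properties as Fin
open import Data.List using (List; []; _∷_; length; filter; lookup; map; upTo)
open import Data.List.Properties using (length-map; length-upTo)
open import Data.List.Membership.Propositional using (_∈_; _∉_)
open import Data.List.Membership.Propositional.Properties using (∈-lookup; ∈-filter⁻; ∈-map⁻)
import Data.List.Membership.DecPropositional as DecMembership
open import Data.List.Relation.Binary.Subset.Propositional using (_⊆_)
import Data.List.Relation.Binary.Sublist.Propositional.Properties as Sublist
import Data.List.Relation.Unary.All as All
open import Data.List.Relation.Unary.AllPairs using (_∷_)
open import Data.List.Relation.Unary.Any using (here; there; index)
open import Data.List.Relation.Unary.Any.Properties using (lookup-index)
open import Data.List.Relation.Unary.Unique.Propositional using (Unique)
import Data.List.Relation.Unary.Unique.Propositional.Properties as Unique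
import Data.Nat as ℕ
open import Data.Nat using (ℕ; zero; suc; _+_; _*_; _≤_; _<_; s≤s; _<?_)
open import Data.Nat.Properties
  using (+-suc; +-comm; *-suc; +-monoˡ-≤; +-monoʳ-≤; +-cancelˡ-≤; +-cancelˡ-<;
         <-≤-trans; <⇒≤; ≮⇒≥; ≰⇒>; module ≤-Reasoning)
open import Data.Product using (∃-syntax; _×_; _,_; proj₁; proj₂; map₂)
open import Function using (id; _∘_)
open import Function.Definitions using (Injective)
open import Relation.Binary.Definitions using (DecidableEquality)
open import Relation.Binary.PropositionalEquality
  using (_≡_; _≢_; refl; sym; trans; cong; subst; module ≡-Reasoning)
open import Relation.Nullary using (¬_; yes; no; contradiction)
open import Relation.Unary using (Decidable)
open import Relation.Unary.Properties using (∁?)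

module _ {A : Set} where

  lookup-injective : {xs : List A} → Unique xs → Injective _≡_ _≡_ (lookup xs)
  lookup-injective (_ ∷ _)     {zero}  {zero}  _  = refl
  lookup-injective (x∉xs ∷ _)  {zero}  {suc j} eq = contradiction eq (All.lookup x∉xs (∈-lookup j))
  lookup-injective (x∉xs ∷ _)  {suc i} {zero}  eq = contradiction (sym eq) (All.lookup x∉xs (∈-lookup i))
  lookup-injective (_ ∷ uniq)  {suc i} {suc j} eq = cong suc (lookup-injective uniq eq)

  -- If ys were shorter, two positions of xs would be sent to the same position of ys.
  unique⊆⇒length≤ : {xs ys : List A} → Unique xs → xs ⊆ ys → length xs ≤ length ys
  unique⊆⇒length≤ {xs} {ys} uniq xs⊆ys = ≮⇒≥ λ ys<xs →
    let i , j , i<j , same = Fin.pigeonhole ys<xs position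
    in contradiction (lookup-injective uniq (collision same)) (Fin.<⇒≢ i<j)
    where
      position : Fin (length xs) → Fin (length ys)
      position i = index (xs⊆ys (∈-lookup i))

      collision : ∀ {i j} → position i ≡ position j → lookup xs i ≡ lookup xs j
      collision {i} {j} same = begin
        lookup xs i             ≡⟨ lookup-index (xs⊆ys (∈-lookup i)) ⟩
        lookup ys (position i)  ≡⟨ cong (lookup ys) same ⟩
        lookup ys (position j)  ≡⟨ sym (lookup-index (xs⊆ys (∈-lookup j))) ⟩
        lookup xs j             ∎
        where open ≡-Reasoning

  length-filter-∁ : {P : A → Set} (P? : Decidable P) (xs : List A) →
                    length (filter P? xs) + length (filter (∁? P?) xs) ≡ length xs
  length-filter-∁ P? []       = refl
  length-filter-∁ P? (x ∷ xs) with P? x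
  ... | yes _ = cong suc (length-filter-∁ P? xs)
  ... | no  _ = trans (+-suc _ _) (cong suc (length-filter-∁ P? xs))

module DecidableLists {A : Set} (_≟ᴬ_ : DecidableEquality A) where
  open DecMembership _≟ᴬ_ using (_∈?_)

  outside : List A → List A → List A
  outside ys = filter (∁? (_∈? ys))

  ∈-outside⁻ : ∀ {x} ys xs → x ∈ outside ys xs → x ∈ xs × x ∉ ys
  ∈-outside⁻ ys xs = ∈-filter⁻ (∁? (_∈? ys)) {xs = xs}

  length≤length+outside : {xs : List A} (ys : List A) → Unique xs →
                          length xs ≤ length ys + length (outside ys xs)
  length≤length+outside {xs} ys uniq = begin
    length xs                                               ≡⟨ sym (length-filter-∁ (_∈? ys) xs) ⟩
    length (filter (_∈? ys) xs) + length (outside ys xs)    ≤⟨ +-monoˡ-≤ _ inside≤ys ⟩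
    length ys + length (outside ys xs)                      ∎
    where
      open ≤-Reasoning
      inside≤ys : length (filter (_∈? ys) xs) ≤ length ys
      inside≤ys = unique⊆⇒length≤ (Unique.filter⁺ (_∈? ys) uniq) (proj₂ ∘ ∈-filter⁻ (_∈? ys) {xs = xs})

open DecidableLists ℕ._≟_

pigeonhole-cover : {A B : Set} {R : B → A → Set} (R? : ∀ b → Decidable (R b)) (r : ℕ)
                   (bs : List B) (zs : List A) → (∀ {z} → z ∈ zs → ∃[ b ] b ∈ bs × R b z) →
                   r * length bs < length zs → ∃[ b ] b ∈ bs × r < length (filter (R? b) zs)
pigeonhole-cover R? r [] (z ∷ zs) cover _ with cover (here refl)
... | _ , () , _
pigeonhole-cover {A} {R = R} R? r (b ∷ bs) zs cover r*∣b∷bs∣<∣zs∣ with r <? length (filter (R? b) zs)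
... | yes r<∣Rb∣ = b , here refl , r<∣Rb∣
... | no  r≮∣Rb∣ =
  let b′ , b′∈bs , r<∣Rb′∣ = pigeonhole-cover R? r bs rest cover-rest r*∣bs∣<∣rest∣
  in b′ , there b′∈bs , <-≤-trans r<∣Rb′∣ (Sublist.length-mono-≤
       (Sublist.filter⁺ (R? b′) (R? b′) (λ { refl → id }) (Sublist.filter-⊆ (∁? (R? b)) zs)))
  where
    rest : List A
    rest = filter (∁? (R? b)) zs

    cover-rest : ∀ {z} → z ∈ rest → ∃[ b′ ] b′ ∈ bs × R b′ z
    cover-rest z∈rest with ∈-filter⁻ (∁? (R? b)) z∈rest
    ... | z∈zs , ¬Rbz with cover z∈zs
    ...   | _ , here refl , Rbz    = contradiction Rbz ¬Rbz
    ...   | b′ , there b′∈bs , Rb′z = b′ , b′∈bs , Rb′z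

    r*∣bs∣<∣rest∣ : r * length bs < length rest
    r*∣bs∣<∣rest∣ = +-cancelˡ-< r _ _ (begin-strict
      r + r * length bs                               ≡⟨ sym (*-suc r (length bs)) ⟩
      r * length (b ∷ bs)                             <⟨ r*∣b∷bs∣<∣zs∣ ⟩
      length zs                                       ≡⟨ sym (length-filter-∁ (R? b) zs) ⟩
      length (filter (R? b) zs) + length rest         ≤⟨ +-monoˡ-≤ (length rest) (≮⇒≥ r≮∣Rb∣) ⟩
      r + length rest                                 ∎)
      where open ≤-Reasoning

_∘ᵃ_ : {E : ℕ → ℕ → Bool} → Automorphism E → Automorphism E → Automorphism E
σ ∘ᵃ τ = record
  { fun       = fun σ ∘ fun τ
  ; inv       = inv τ ∘ inv σ
  ; inv-l     = λ x → trans (cong (inv τ) (inv-l σ (fun τ x))) (inv-l τ x)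
  ; inv-r     = λ x → trans (cong (fun σ) (inv-r τ (inv σ x))) (inv-r σ x)
  ; preserves = λ x y → trans (preserves σ (fun τ x) (fun τ y)) (preserves τ x y)
  }

-- The partial map b ↦ x fixing S pointwise is an embedding of |S| + 1 vertices.
agreeing⇒sameOrbit : {E : ℕ → ℕ → Bool} {k : ℕ} → IsGraph E → GeHomogeneous k E →
                     {x b : ℕ} {S : List ℕ} → Unique (b ∷ S) → Unique (x ∷ S) →
                     k ≤ suc (length S) → (∀ {s} → s ∈ S → E x s ≡ E b s) → SameOrbit E b x
agreeing⇒sameOrbit {E} graph hom {x} {b} {S} uniq-b uniq-x k≤ agree =
  map₂ (λ extends → extends zero)
       (hom (suc (length S)) k≤ (lookup (b ∷ S)) (lookup (x ∷ S))
            (lookup-injective uniq-b) (lookup-injective uniq-x) edges)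
  where
    open IsGraph graph renaming (sym to E-sym)

    edges : ∀ i j → E (lookup (x ∷ S) i) (lookup (x ∷ S) j) ≡ E (lookup (b ∷ S) i) (lookup (b ∷ S) j)
    edges zero    zero    = trans (irrefl x) (sym (irrefl b))
    edges zero    (suc j) = agree (∈-lookup j)
    edges (suc i) zero    = trans (E-sym _ x) (trans (agree (∈-lookup i)) (E-sym b _))
    edges (suc i) (suc j) = refl

module TwoOrbits
  {E : ℕ → ℕ → Bool} (graph : IsGraph E) {k₀ : ℕ} (hom : GeHomogeneous (suc k₀) E)
  {qs : List ℕ} {b₀ : ℕ} (b₀∈qs : b₀ ∈ qs)
  (orbit-of-b₀ : ∀ x → (x ∈ qs → SameOrbit E b₀ x) × (SameOrbit E b₀ x → x ∈ qs))
  (complement : ComplementIsOrbit E qs) where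

  orbit-closed : ∀ {b x} → b ∈ qs → SameOrbit E b x → x ∈ qs
  orbit-closed {b} {x} b∈qs (σ , σb≡x) =
    let τ , τb₀≡b = proj₁ (orbit-of-b₀ b) b∈qs
    in proj₂ (orbit-of-b₀ x) (σ ∘ᵃ τ , trans (cong (fun σ) τb₀≡b) σb≡x)

  Dominated : Set
  Dominated = ∀ {z} → z ∉ qs → ∃[ b ] b ∈ qs × E b z ≡ true

  edge-to-complement⇒dominated : ∀ {b y} → b ∈ qs → y ∉ qs → E b y ≡ true → Dominated
  edge-to-complement⇒dominated {b} {y} b∈qs y∉qs Eby≡true {z} z∉qs =
    let σ , σy≡z = complement y z y∉qs z∉qs
    in fun σ b , orbit-closed b∈qs (σ , refl) , (begin
         E (fun σ b) z          ≡⟨ cong (E (fun σ b)) (sym σy≡z) ⟩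
         E (fun σ b) (fun σ y)  ≡⟨ preserves σ b y ⟩
         E b y                  ≡⟨ Eby≡true ⟩
         true                   ∎)
    where open ≡-Reasoning

  no-large-clique-with-common-neighbour :
    ∀ {b} → b ∈ qs → (C : List ℕ) → Unique C → k₀ < length C →
    (∀ {z} → z ∈ C → z ∉ qs × E b z ≡ true) →
    (∀ {y z} → y ∈ C → z ∈ C → y ≢ z → E y z ≡ true) → ⊥
  no-large-clique-with-common-neighbour {b} b∈qs (c ∷ S) (c∉S ∷ uniq) k₀<∣c∷S∣ common adjacent =
    proj₁ (common (here refl))
      (orbit-closed b∈qs (agreeing⇒sameOrbit graph hom uniq-b (c∉S ∷ uniq) k₀<∣c∷S∣ agree))
    where
      uniq-b : Unique (b ∷ S)
      uniq-b = All.tabulate (λ s∈S b≡s → proj₁ (common (there s∈S)) (subst (_∈ qs) b≡s b∈qs)) ∷ uniq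

      agree : ∀ {s} → s ∈ S → E c s ≡ E b s
      agree s∈S = trans (adjacent (here refl) (there s∈S) (All.lookup c∉S s∈S))
                        (sym (proj₂ (common (there s∈S))))

  not-dominated : ContainsKω E → ¬ Dominated
  not-dominated (h , h-injective , h-adjacent) dominated =
    let b , b∈qs , k₀<∣bucket∣ = pigeonhole-cover adjacent? k₀ qs outs (dominated ∘ outs-outside) many
    in no-large-clique-with-common-neighbour b∈qs (filter (adjacent? b) outs)
         (Unique.filter⁺ _ uniq-outs) k₀<∣bucket∣ (bucket-facts b)
         (λ y∈ z∈ → members-adjacent (bucket⊆members b y∈) (bucket⊆members b z∈))
    where
      N : ℕ
      N = length qs + suc (k₀ * length qs)

      members : List ℕ
      members = map h (upTo N)

      uniq-members : Unique members
      uniq-members = Unique.map⁺ h-injective (Unique.upTo⁺ N)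

      members-adjacent : ∀ {y z} → y ∈ members → z ∈ members → y ≢ z → E y z ≡ true
      members-adjacent y∈ z∈ y≢z with ∈-map⁻ h y∈ | ∈-map⁻ h z∈
      ... | m , _ , refl | n , _ , refl = h-adjacent m n (y≢z ∘ cong h)

      outs : List ℕ
      outs = outside qs members

      uniq-outs : Unique outs
      uniq-outs = Unique.filter⁺ _ uniq-members

      outs-outside : ∀ {z} → z ∈ outs → z ∉ qs
      outs-outside z∈outs = proj₂ (∈-outside⁻ qs members z∈outs)

      many : k₀ * length qs < length outs
      many = +-cancelˡ-≤ (length qs) _ _ (begin
        length qs + suc (k₀ * length qs)  ≡⟨ sym (trans (length-map h (upTo N)) (length-upTo N)) ⟩
        length members                    ≤⟨ length≤length+outside qs uniq-members ⟩
        length qs + length outs           ∎)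
        where open ≤-Reasoning

      adjacent? : ∀ b → Decidable (λ z → E b z ≡ true)
      adjacent? b z = E b z ≟ true

      bucket-facts : ∀ b {z} → z ∈ filter (adjacent? b) outs → z ∉ qs × E b z ≡ true
      bucket-facts b z∈ = let z∈outs , Ebz≡true = ∈-filter⁻ (adjacent? b) z∈
                          in outs-outside z∈outs , Ebz≡true

      bucket⊆members : ∀ b {z} → z ∈ filter (adjacent? b) outs → z ∈ members
      bucket⊆members b z∈ = proj₁ (∈-outside⁻ qs members (proj₁ (∈-filter⁻ (adjacent? b) z∈)))

  complement-nonadjacent : ContainsKω E → ∀ {b y} → b ∈ qs → y ∉ qs → E b y ≡ false
  complement-nonadjacent clique b∈qs y∉qs =
    ¬-not (not-dominated clique ∘ edge-to-complement⇒dominated b∈qs y∉qs)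

  nonNeighbours-bounded : ContainsKω E → ∀ {a} → a ∉ qs → NonNeighboursAtMost E a (k₀ + length qs)
  nonNeighbours-bounded clique {a} a∉qs xs uniq nonadjacent = begin
    length xs                   ≤⟨ length≤length+outside qs uniq ⟩
    length qs + length outs     ≤⟨ +-monoʳ-≤ (length qs) (<⇒≤ ∣outs∣<k₀) ⟩
    length qs + k₀              ≡⟨ +-comm (length qs) k₀ ⟩
    k₀ + length qs              ∎
    where
      open ≤-Reasoning
      outs : List ℕ
      outs = outside qs xs

      outs-facts : ∀ {s} → s ∈ outs → (s ≢ a × E a s ≡ false) × s ∉ qs
      outs-facts {s} s∈outs = let s∈xs , s∉qs = ∈-outside⁻ qs xs s∈outs in nonadjacent s s∈xs , s∉qs

      uniq-outs : Unique outs
      uniq-outs = Unique.filter⁺ _ uniq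

      uniq-a : Unique (a ∷ outs)
      uniq-a = All.tabulate (λ s∈outs a≡s → proj₁ (proj₁ (outs-facts s∈outs)) (sym a≡s)) ∷ uniq-outs

      uniq-b₀ : Unique (b₀ ∷ outs)
      uniq-b₀ = All.tabulate (λ s∈outs b₀≡s → proj₂ (outs-facts s∈outs) (subst (_∈ qs) b₀≡s b₀∈qs)) ∷ uniq-outs

      agree : ∀ {s} → s ∈ outs → E a s ≡ E b₀ s
      agree s∈outs = let (_ , Eas≡false) , s∉qs = outs-facts s∈outs
                     in trans Eas≡false (sym (complement-nonadjacent clique b₀∈qs s∉qs))

      ∣outs∣<k₀ : length outs < k₀
      ∣outs∣<k₀ = ≰⇒> λ k₀≤∣outs∣ →
        a∉qs (orbit-closed b₀∈qs (agreeing⇒sameOrbit graph hom uniq-b₀ uniq-a (s≤s k₀≤∣outs∣) agree))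

lemma4 : (k : ℕ) → (E : ℕ → ℕ → Bool) → IsGraph E → k ℕ.≥ 1 →
         GeHomogeneous k E → ¬ Homogeneous 1 E → ContainsKω E →
         (qs : List ℕ) → IsFiniteOrbit E qs → ComplementIsOrbit E qs →
         (a : ℕ) → a ∉ qs → NonNeighboursAtMost E a (k + length qs ℕ.∸ 1)
lemma4 zero _ _ () _ _ _ _ _ _ _ _
lemma4 (suc k₀) E graph _ hom _ clique qs (_ , b₀ , b₀∈qs , orbit-of-b₀) complement a a∉qs =
  TwoOrbits.nonNeighbours-bounded graph hom b₀∈qs orbit-of-b₀ complement clique a∉qs
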